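{- Let $m\ge 3$ and $n\ge 1$ be integers. Then there exists a vector $\mathbf{a}\in\mathcal N$ such that $R'_{\mathcal{GP}_m}(\mathbf{a})=\mathcal T(n)$.
   Context: For an integer $m\ge 3$ let $P_m(x)=\frac{(m-2)x^2-(m-4)x}{2}$ and let $\mathcal{GP}_m=\{P_m(u):u\in\mathbb Z\}$ be the set of generalized $m$-gonal numbers. For $k\ge 1$ let $\mathcal N(k)=\{(a_1,\dots,a_k)\in\mathbb N^k: a_1\le a_2\le\cdots\le a_k\}$ (with $\mathbb N$ the positive integers) and $\mathcal N=\bigcup_{k\ge1}\mathcal N(k)$. For $\mathbf a=(a_1,\dots,a_k)\in\mathcal N(k)$ put $R_{\mathcal{GP}_m}(\mathbf a)=\{a_1s_1+\cdots+a_ks_k: s_i\in\mathcal{GP}_m\}$ and $R'_{\mathcal{GP}_m}(\mathbf a)=R_{\mathcal{GP}_m}(\mathbf a)\setminus\{0\}$ (the nonzero integers represented by the form $a_1P_m(x_1)+\cdots+a_kP_m(x_k)$). For a positive integer $n$, $\mathcal T(n)$ denotes the set of all integers $\ge n$. -}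

module Defs where

open import Data.Nat as ℕ using (ℕ; zero; suc)
open import Data.Integer as ℤ using (ℤ; +_; _+_; _-_; _*_)
open import Data.Fin using (Fin; zero; suc)
open import Data.Product using (Σ; ∃; _×_)
open import Relation.Binary.PropositionalEquality using (_≡_; _≢_)

-- P_m(x) = ((m-2)x^2 - (m-4)x)/2 ; we record 2 * P_m(x) to avoid division
-- (the numerator is always even, so this is exact).
twiceP : ℕ → ℤ → ℤ
twiceP m x = ((+ m) - + 2) * (x * x) - ((+ m) - + 4) * x

IsGP : ℕ → ℤ → Set
IsGP m s = ∃ λ (u : ℤ) → + 2 * s ≡ twiceP m u

linComb : (k : ℕ) → (Fin k → ℕ) → (Fin k → ℤ) → ℤ
linComb zero    a s = + 0
linComb (suc k) a s = (+ a zero) * s zero + linComb k (λ i → a (suc i)) (λ i → s (suc i))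

InN : (k : ℕ) → (Fin k → ℕ) → Set
InN k a = (∀ i → 1 ℕ.≤ a i) × (∀ i j → Data.Fin._≤_ i j → a i ℕ.≤ a j)

Represented : ℕ → (k : ℕ) → (Fin k → ℕ) → ℤ → Set
Represented m k a x = Σ (Fin k → ℤ) λ s → (∀ i → IsGP m (s i)) × x ≡ linComb k a s

Represented' : ℕ → (k : ℕ) → (Fin k → ℕ) → ℤ → Set
Represented' m k a x = Represented m k a x × x ≢ + 0

-- Take the coefficients n (eight times), n, n + 1, …, n + l − 1 with l = n(m − 2).
-- For m ≥ 3 every generalized m-gonal number is nonnegative, since
-- P_m(u) = binom(u + 1, 2) + (m − 3) binom(u, 2); so a nonzero value of the form is at least n.
-- Conversely write x − n = l Q + r with 0 ≤ r < l and Q = u₁² + u₂² + u₃² + u₄² (Lagrange).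
-- As P_m(u) + P_m(−u) = (m − 2) u², the first eight terms with the arguments ±uᵢ give n (m − 2) Q = l Q,
-- and P_m(1) = 1 taken at the coefficient n + r gives the rest.
-- Lagrange's theorem is proved classically: Euler's identity reduces it to primes; pigeonholing
-- x² against −1 − y² modulo an odd prime p gives a multiple m p = x² + y² + 1 with m < p; and
-- Euler's descent brings m down to 1.

module Submission where

open import Defs
open import Data.Nat as ℕ using (ℕ; zero; suc; z≤n; s≤s; _≤_)
import Data.Nat.Properties as ℕ
import Data.Nat.Tactic.RingSolver as NS
open import Data.Nat.DivMod using (_%_; _/_; _mod_; m≡m%n+[m/n]*n; m%n<n)
open import Data.Nat.Divisibility using (_∣_; divides; >⇒∤; ∣m+n∣m⇒∣n; m∣m*n; n∣m*n)
open import Data.Nat.Induction using (<-rec)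
open import Data.Nat.ListAction using (product)
open import Data.Nat.Primality using (Prime; prime⇒¬composite; composite; euclidsLemma; ¬prime[0]; ¬prime[1])
open import Data.Nat.Primality.Factorisation using (PrimeFactorisation; factorise)
open import Data.Integer as ℤ using (ℤ; +_; -[1+_]; _+_; _-_; _*_; -_; ∣_∣; _⊖_; +≤+)
import Data.Integer.Properties as ℤ
open import Data.Integer.DivMod using (_%ℕ_; _/ℕ_; n%ℕd<d; a≡a%ℕn+[a/ℕn]*n)
open import Data.Integer.Solver using (module +-*-Solver)
open import Data.Integer.Tactic.RingSolver using (solve-∀; solve)
open import Data.Fin as Fin using (Fin; toℕ; opposite; splitAt; _↑ˡ_; _↑ʳ_)
import Data.Fin.Properties as Fin
open import Data.List using (_∷_; [])
open import Data.List.Relation.Unary.All as All using (All)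
open import Data.Product using (Σ; ∃; ∃₂; _×_; _,_; proj₁; proj₂)
open import Data.Sum using (_⊎_; inj₁; inj₂; [_,_]′)
open import Function using (_∘_; _⇔_; mk⇔)
open import Relation.Binary.PropositionalEquality
open import Relation.Nullary using (contradiction)

open +-*-Solver using (_:=_; _:+_; _:-_; _:*_; con; Polynomial) renaming (solve to solveₚ)

-- Lagrange's four-square theorem

sumSq : ℤ → ℤ → ℤ → ℤ → ℤ
sumSq a b c d = a * a + b * b + c * c + d * d

-- The reflective solver does not unfold sumSq, so identities mentioning it use this polynomial.
private
  sumSqₚ : ∀ {n} → Polynomial n → Polynomial n → Polynomial n → Polynomial n → Polynomial n
  sumSqₚ a b c d = a :* a :+ b :* b :+ c :* c :+ d :* d

record FourSquares (n : ℤ) : Set where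
  constructor fourSquares
  field
    x₁ x₂ x₃ x₄ : ℤ
    n≡sumSq : n ≡ sumSq x₁ x₂ x₃ x₄

eulerFourSquare : ∀ a b c d a′ b′ c′ d′ →
  sumSq a b c d * sumSq a′ b′ c′ d′ ≡
  sumSq (a * a′ + b * b′ + c * c′ + d * d′) (a * b′ - b * a′ + c * d′ - d * c′)
        (a * c′ - b * d′ - c * a′ + d * b′) (a * d′ + b * c′ - c * b′ - d * a′)
eulerFourSquare = solveₚ 8 (λ a b c d a′ b′ c′ d′ →
  sumSqₚ a b c d :* sumSqₚ a′ b′ c′ d′ :=
  sumSqₚ (a :* a′ :+ b :* b′ :+ c :* c′ :+ d :* d′) (a :* b′ :- b :* a′ :+ c :* d′ :- d :* c′)
         (a :* c′ :- b :* d′ :- c :* a′ :+ d :* b′) (a :* d′ :+ b :* c′ :- c :* b′ :- d :* a′)) refl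

fourSquares-* : ∀ {m n} → FourSquares m → FourSquares n → FourSquares (m * n)
fourSquares-* (fourSquares a b c d m≡) (fourSquares a′ b′ c′ d′ n≡) =
  fourSquares (a * a′ + b * b′ + c * c′ + d * d′) (a * b′ - b * a′ + c * d′ - d * c′)
              (a * c′ - b * d′ - c * a′ + d * b′) (a * d′ + b * c′ - c * b′ - d * a′)
              (trans (cong₂ _*_ m≡ n≡) (eulerFourSquare a b c d a′ b′ c′ d′))

evenOrOdd : ∀ x → (∃ λ q → x ≡ + 2 * q) ⊎ (∃ λ q → x ≡ + 2 * q + + 1)
evenOrOdd x with x %ℕ 2 | x /ℕ 2 | n%ℕd<d x 2 | a≡a%ℕn+[a/ℕn]*n x 2
... | 0           | q | _             | x≡ =
  inj₁ (q , trans x≡ (trans (ℤ.+-identityˡ _) (ℤ.*-comm q (+ 2))))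
... | 1           | q | _             | x≡ =
  inj₂ (q , trans x≡ (trans (ℤ.+-comm (+ 1) (q * + 2)) (cong (_+ + 1) (ℤ.*-comm q (+ 2)))))
... | suc (suc _) | _ | s≤s (s≤s ()) | _

even≢odd : ∀ x y → + 2 * x ≢ + 2 * y + + 1
even≢odd x y 2x≡2y+1 = ℕ.even≢odd ∣ x - y ∣ 0 (begin
  2 ℕ.* ∣ x - y ∣    ≡⟨ ℤ.abs-* (+ 2) (x - y) ⟨
  ∣ + 2 * (x - y) ∣  ≡⟨ cong ∣_∣ 2[x-y]≡1 ⟩
  1                  ∎)
  where
  open ≡-Reasoning
  2[x-y]≡1 : + 2 * (x - y) ≡ + 1
  2[x-y]≡1 = begin
    + 2 * (x - y)              ≡⟨ solve (x ∷ y ∷ []) ⟩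
    + 2 * x - + 2 * y          ≡⟨ cong (_- + 2 * y) 2x≡2y+1 ⟩
    + 2 * y + + 1 - + 2 * y    ≡⟨ solve (y ∷ []) ⟩
    + 1                        ∎

a≡[a+b]-b : ∀ a b → a ≡ (a + b) - b
a≡[a+b]-b = solve-∀

halveByEvenPairs : ∀ {n} a b c d {s t} → + 2 * n ≡ sumSq a b c d →
                   a + b ≡ + 2 * s → c + d ≡ + 2 * t → FourSquares n
halveByEvenPairs {n} a b c d {s} {t} 2n≡ a+b≡ c+d≡ =
  fourSquares s (s - b) t (t - d) (ℤ.*-cancelˡ-≡ (+ 2) n _ (begin
    + 2 * n                                ≡⟨ 2n≡ ⟩
    sumSq a b c d                          ≡⟨ cong₂ (λ a c → sumSq a b c d) a≡ c≡ ⟩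
    sumSq (+ 2 * s - b) b (+ 2 * t - d) d  ≡⟨ doubled s b t d ⟩
    + 2 * sumSq s (s - b) t (t - d)        ∎))
  where
  open ≡-Reasoning
  a≡ = trans (a≡[a+b]-b a b) (cong (_- b) a+b≡)
  c≡ = trans (a≡[a+b]-b c d) (cong (_- d) c+d≡)
  doubled : ∀ s b t d → sumSq (+ 2 * s - b) b (+ 2 * t - d) d ≡ + 2 * sumSq s (s - b) t (t - d)
  doubled = solveₚ 4 (λ s b t d → sumSqₚ (con (+ 2) :* s :- b) b (con (+ 2) :* t :- d) d
                                 := con (+ 2) :* sumSqₚ s (s :- b) t (t :- d)) refl

halveGivenEvenPair : ∀ {n} a b c d {s} → + 2 * n ≡ sumSq a b c d → a + b ≡ + 2 * s → FourSquares n
halveGivenEvenPair {n} a b c d {s} 2n≡ a+b≡ with evenOrOdd (c + d)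
... | inj₁ (t , c+d≡) = halveByEvenPairs a b c d 2n≡ a+b≡ c+d≡
... | inj₂ (t , c+d≡) = contradiction (begin
    + 2 * n                                      ≡⟨ 2n≡ ⟩
    sumSq a b c d                                ≡⟨ cong₂ (λ a c → sumSq a b c d) a≡ c≡ ⟩
    sumSq (+ 2 * s - b) b (+ 2 * t + + 1 - d) d  ≡⟨ odd s b t d ⟩
    + 2 * k + + 1                                ∎) (even≢odd n k)
  where
  open ≡-Reasoning
  a≡ = trans (a≡[a+b]-b a b) (cong (_- b) a+b≡)
  c≡ = trans (a≡[a+b]-b c d) (cong (_- d) c+d≡)
  k = + 2 * s * s - + 2 * s * b + b * b + + 2 * t * t + + 2 * t - + 2 * t * d - d + d * d
  odd : ∀ s b t d → sumSq (+ 2 * s - b) b (+ 2 * t + + 1 - d) d ≡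
        + 2 * (+ 2 * s * s - + 2 * s * b + b * b + + 2 * t * t + + 2 * t - + 2 * t * d - d + d * d) + + 1
  odd = solveₚ 4 (λ s b t d → sumSqₚ (con (+ 2) :* s :- b) b (con (+ 2) :* t :+ con (+ 1) :- d) d
    := con (+ 2) :* (con (+ 2) :* s :* s :- con (+ 2) :* s :* b :+ b :* b :+ con (+ 2) :* t :* t
                     :+ con (+ 2) :* t :- con (+ 2) :* t :* d :- d :+ d :* d) :+ con (+ 1)) refl

-- If a + b and a + c are both odd then b + c is even; the two remaining terms then have an
-- even sum as well, and 2 (s² + (s − b)²) = a² + b² for a + b = 2 s.
fourSquares-half : ∀ {n} a b c d → + 2 * n ≡ sumSq a b c d → FourSquares n
fourSquares-half a b c d 2n≡ with evenOrOdd (a + b) | evenOrOdd (a + c)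
... | inj₁ (_ , a+b≡) | _ = halveGivenEvenPair a b c d 2n≡ a+b≡
... | inj₂ _ | inj₁ (_ , a+c≡) =
  halveGivenEvenPair a c b d (trans 2n≡ (swap a b c d)) a+c≡
  where
  swap : ∀ a b c d → sumSq a b c d ≡ sumSq a c b d
  swap = solveₚ 4 (λ a b c d → sumSqₚ a b c d := sumSqₚ a c b d) refl
... | inj₂ (u , a+b≡) | inj₂ (v , a+c≡) =
  halveGivenEvenPair b c a d (trans 2n≡ (rotate a b c d)) b+c≡
  where
  rotate : ∀ a b c d → sumSq a b c d ≡ sumSq b c a d
  rotate = solveₚ 4 (λ a b c d → sumSqₚ a b c d := sumSqₚ b c a d) refl
  b+c≡ : b + c ≡ + 2 * (u + v + + 1 - a)
  b+c≡ = begin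
    b + c                                  ≡⟨ solve (a ∷ b ∷ c ∷ []) ⟩
    (a + b) + (a + c) - + 2 * a            ≡⟨ cong₂ (λ x y → x + y - + 2 * a) a+b≡ a+c≡ ⟩
    (+ 2 * u + + 1) + (+ 2 * v + + 1) - + 2 * a ≡⟨ solve (a ∷ u ∷ v ∷ []) ⟩
    + 2 * (u + v + + 1 - a)                ∎
    where open ≡-Reasoning

centredResidue : ∀ g a → ∃₂ λ r q → a ≡ r + + suc (2 ℕ.* g) * q × ∣ r ∣ ℕ.≤ g
centredResidue g a = r ⊖ g , q , a≡ , ∣r⊖g∣≤g
  where
  m = suc (2 ℕ.* g)
  r = (a + + g) %ℕ m
  q = (a + + g) /ℕ m
  a≡ : a ≡ r ⊖ g + + m * q
  a≡ = begin
    a                          ≡⟨ a≡[a+b]-b a (+ g) ⟩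
    (a + + g) - + g            ≡⟨ cong (_- + g) (a≡a%ℕn+[a/ℕn]*n (a + + g) m) ⟩
    (+ r + q * + m) - + g      ≡⟨ regroup (+ r) q (+ m) (+ g) ⟩
    (+ r - + g) + + m * q      ≡⟨ cong (_+ + m * q) (ℤ.[+m]-[+n]≡m⊖n r g) ⟩
    r ⊖ g + + m * q            ∎
    where
    open ≡-Reasoning
    regroup : ∀ r q m g → (r + q * m) - g ≡ (r - g) + m * q
    regroup = solve-∀
  r≤g+g : r ℕ.≤ g ℕ.+ g
  r≤g+g = ℕ.≤-trans (ℕ.≤-pred (n%ℕd<d (a + + g) m)) (ℕ.≤-reflexive (cong (g ℕ.+_) (ℕ.+-identityʳ g)))
  ∣r⊖g∣≤g : ∣ r ⊖ g ∣ ℕ.≤ g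
  ∣r⊖g∣≤g with ℕ.≤-total r g
  ... | inj₁ r≤g = ℕ.≤-trans (ℕ.≤-reflexive (ℤ.∣⊖∣-≤ r≤g)) (ℕ.m∸n≤m g r)
  ... | inj₂ g≤r = ℕ.≤-trans (ℕ.≤-reflexive (trans (ℤ.∣m⊖n∣≡∣n⊖m∣ r g) (ℤ.∣⊖∣-≤ g≤r)))
                              (ℕ.m≤n+o⇒m∸n≤o r g r≤g+g)

sumSq-centred : ∀ M A B C D qa qb qc qd →
  sumSq (A + M * qa) (B + M * qb) (C + M * qc) (D + M * qd) ≡
  sumSq A B C D + M * (+ 2 * (A * qa + B * qb + C * qc + D * qd) + M * sumSq qa qb qc qd)
sumSq-centred = solveₚ 9 (λ M A B C D qa qb qc qd →
  sumSqₚ (A :+ M :* qa) (B :+ M :* qb) (C :+ M :* qc) (D :+ M :* qd) :=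
  sumSqₚ A B C D :+ M :* (con (+ 2) :* (A :* qa :+ B :* qb :+ C :* qc :+ D :* qd) :+ M :* sumSqₚ qa qb qc qd)) refl

euler-centred : ∀ M A B C D qa qb qc qd →
  sumSq (A + M * qa) (B + M * qb) (C + M * qc) (D + M * qd) * sumSq A B C D ≡
  sumSq (sumSq A B C D + M * (qa * A + qb * B + qc * C + qd * D)) (M * (qa * B - qb * A + qc * D - qd * C))
        (M * (qa * C - qb * D - qc * A + qd * B)) (M * (qa * D + qb * C - qc * B - qd * A))
euler-centred = solveₚ 9 (λ M A B C D qa qb qc qd →
  sumSqₚ (A :+ M :* qa) (B :+ M :* qb) (C :+ M :* qc) (D :+ M :* qd) :* sumSqₚ A B C D :=
  sumSqₚ (sumSqₚ A B C D :+ M :* (qa :* A :+ qb :* B :+ qc :* C :+ qd :* D)) (M :* (qa :* B :- qb :* A :+ qc :* D :- qd :* C))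
         (M :* (qa :* C :- qb :* D :- qc :* A :+ qd :* B)) (M :* (qa :* D :+ qb :* C :- qc :* B :- qd :* A))) refl

fourSquares-divide : ∀ M {p R} A B C D qa qb qc qd .{{_ : ℤ.NonZero M}} →
  M * p ≡ sumSq (A + M * qa) (B + M * qb) (C + M * qc) (D + M * qd) →
  sumSq A B C D ≡ M * R → FourSquares (R * p)
fourSquares-divide M {p} {R} A B C D qa qb qc qd Mp≡ S≡ =
  fourSquares (R + X) w₂ w₃ w₄ (ℤ.*-cancelˡ-≡ M _ _ (ℤ.*-cancelˡ-≡ M _ _ (begin
    M * (M * (R * p))                                              ≡⟨ solve (M ∷ R ∷ p ∷ []) ⟩
    (M * p) * (M * R)                                              ≡⟨ cong₂ _*_ Mp≡ (sym S≡) ⟩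
    sumSq (A + M * qa) (B + M * qb) (C + M * qc) (D + M * qd) * S  ≡⟨ euler-centred M A B C D qa qb qc qd ⟩
    sumSq (S + M * X) (M * w₂) (M * w₃) (M * w₄)
      ≡⟨ cong (λ s → sumSq (s + M * X) (M * w₂) (M * w₃) (M * w₄)) S≡ ⟩
    sumSq (M * R + M * X) (M * w₂) (M * w₃) (M * w₄)               ≡⟨ factor M R X w₂ w₃ w₄ ⟩
    M * (M * sumSq (R + X) w₂ w₃ w₄)                               ∎)))
  where
  open ≡-Reasoning
  S  = sumSq A B C D
  X  = qa * A + qb * B + qc * C + qd * D
  w₂ = qa * B - qb * A + qc * D - qd * C
  w₃ = qa * C - qb * D - qc * A + qd * B
  w₄ = qa * D + qb * C - qc * B - qd * A
  factor : ∀ M R X w₂ w₃ w₄ → sumSq (M * R + M * X) (M * w₂) (M * w₃) (M * w₄) ≡ M * (M * sumSq (R + X) w₂ w₃ w₄)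
  factor = solveₚ 6 (λ M R X w₂ w₃ w₄ → sumSqₚ (M :* R :+ M :* X) (M :* w₂) (M :* w₃) (M :* w₄)
                                        := M :* (M :* sumSqₚ (R :+ X) w₂ w₃ w₄)) refl

sumSqℕ : ℕ → ℕ → ℕ → ℕ → ℕ
sumSqℕ x y z w = x ℕ.* x ℕ.+ y ℕ.* y ℕ.+ z ℕ.* z ℕ.+ w ℕ.* w

i*i≡∣i∣*∣i∣ : ∀ i → i * i ≡ + (∣ i ∣ ℕ.* ∣ i ∣)
i*i≡∣i∣*∣i∣ (+ n)    = sym (ℤ.pos-* n n)
i*i≡∣i∣*∣i∣ -[1+ n ] = refl

sumSq≡sumSqℕ : ∀ a b c d → sumSq a b c d ≡ + sumSqℕ (∣ a ∣) (∣ b ∣) (∣ c ∣) (∣ d ∣)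
sumSq≡sumSqℕ a b c d = sym (begin
  + sumSqℕ x y z w                                  ≡⟨ ℤ.pos-+ (x ℕ.* x ℕ.+ y ℕ.* y ℕ.+ z ℕ.* z) (w ℕ.* w) ⟩
  + (x ℕ.* x ℕ.+ y ℕ.* y ℕ.+ z ℕ.* z) + + (w ℕ.* w)
    ≡⟨ cong (_+ + (w ℕ.* w)) (ℤ.pos-+ (x ℕ.* x ℕ.+ y ℕ.* y) (z ℕ.* z)) ⟩
  + (x ℕ.* x ℕ.+ y ℕ.* y) + + (z ℕ.* z) + + (w ℕ.* w)
    ≡⟨ cong (λ t → t + + (z ℕ.* z) + + (w ℕ.* w)) (ℤ.pos-+ (x ℕ.* x) (y ℕ.* y)) ⟩
  + (x ℕ.* x) + + (y ℕ.* y) + + (z ℕ.* z) + + (w ℕ.* w) ≡⟨ squares ⟨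
  sumSq a b c d                                     ∎)
  where
  open ≡-Reasoning
  x = ∣ a ∣; y = ∣ b ∣; z = ∣ c ∣; w = ∣ d ∣
  squares = cong₂ _+_ (cong₂ _+_ (cong₂ _+_ (i*i≡∣i∣*∣i∣ a) (i*i≡∣i∣*∣i∣ b)) (i*i≡∣i∣*∣i∣ c))
                      (i*i≡∣i∣*∣i∣ d)

sumSqℕ≡0⇒≡0 : ∀ x y z w → sumSqℕ x y z w ≡ 0 → x ≡ 0 × y ≡ 0 × z ≡ 0 × w ≡ 0
sumSqℕ≡0⇒≡0 zero zero zero zero _ = refl , refl , refl , refl

sumSqℕ<[1+2g]² : ∀ {g x y z w} → x ℕ.≤ g → y ℕ.≤ g → z ℕ.≤ g → w ℕ.≤ g →
                 sumSqℕ x y z w ℕ.< suc (2 ℕ.* g) ℕ.* suc (2 ℕ.* g)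
sumSqℕ<[1+2g]² {g} {x} {y} {z} {w} x≤g y≤g z≤g w≤g = begin-strict
  sumSqℕ x y z w
    ≤⟨ ℕ.+-mono-≤ (ℕ.+-mono-≤ (ℕ.+-mono-≤ (sq-mono x≤g) (sq-mono y≤g)) (sq-mono z≤g)) (sq-mono w≤g) ⟩
  sumSqℕ g g g g                        <⟨ ℕ.m<m+n (sumSqℕ g g g g) (ℕ.s≤s (ℕ.z≤n {4 ℕ.* g})) ⟩
  sumSqℕ g g g g ℕ.+ suc (4 ℕ.* g)      ≡⟨ square g ⟩
  suc (2 ℕ.* g) ℕ.* suc (2 ℕ.* g)       ∎
  where
  open ℕ.≤-Reasoning
  sq-mono : ∀ {x} → x ℕ.≤ g → x ℕ.* x ℕ.≤ g ℕ.* g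
  sq-mono x≤g = ℕ.*-mono-≤ x≤g x≤g
  square : ∀ g → g ℕ.* g ℕ.+ g ℕ.* g ℕ.+ g ℕ.* g ℕ.+ g ℕ.* g ℕ.+ suc (4 ℕ.* g) ≡
                 suc (2 ℕ.* g) ℕ.* suc (2 ℕ.* g)
  square = NS.solve-∀

cong-sumSq : ∀ {a b c d a′ b′ c′ d′} → a ≡ a′ → b ≡ b′ → c ≡ c′ → d ≡ d′ →
             sumSq a b c d ≡ sumSq a′ b′ c′ d′
cong-sumSq refl refl refl refl = refl

M*p≡S+M*K⇒S≡M*[p-K] : ∀ {M p S K} → M * p ≡ S + M * K → S ≡ M * (p - K)
M*p≡S+M*K⇒S≡M*[p-K] {M} {p} {S} {K} eq = begin
  S                  ≡⟨ a≡[a+b]-b S (M * K) ⟩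
  S + M * K - M * K  ≡⟨ cong (_- M * K) eq ⟨
  M * p - M * K      ≡⟨ solve (M ∷ p ∷ K ∷ []) ⟩
  M * (p - K)        ∎
  where open ≡-Reasoning

sumSq-multiples : ∀ M qa qb qc qd →
  sumSq (+ 0 + M * qa) (+ 0 + M * qb) (+ 0 + M * qc) (+ 0 + M * qd) ≡ M * (M * sumSq qa qb qc qd)
sumSq-multiples = solveₚ 5 (λ M qa qb qc qd →
  sumSqₚ (con (+ 0) :+ M :* qa) (con (+ 0) :+ M :* qb) (con (+ 0) :+ M :* qc) (con (+ 0) :+ M :* qd)
  := M :* (M :* sumSqₚ qa qb qc qd)) refl

zeroResidues⇒∣ : ∀ m {p} qa qb qc qd .{{_ : ℕ.NonZero m}} →
  + m * + p ≡ sumSq (+ 0 + + m * qa) (+ 0 + + m * qb) (+ 0 + + m * qc) (+ 0 + + m * qd) → m ∣ p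
zeroResidues⇒∣ m {p} qa qb qc qd mp≡ = divides ∣ Q ∣ (begin
  p                ≡⟨ cong ∣_∣ p≡M*Q ⟩
  ∣ + m * Q ∣      ≡⟨ ℤ.abs-* (+ m) Q ⟩
  m ℕ.* ∣ Q ∣      ≡⟨ ℕ.*-comm m ∣ Q ∣ ⟩
  ∣ Q ∣ ℕ.* m      ∎)
  where
  open ≡-Reasoning
  Q = sumSq qa qb qc qd
  p≡M*Q : + p ≡ + m * Q
  p≡M*Q = ℤ.*-cancelˡ-≡ (+ m) (+ p) (+ m * Q) (trans mp≡ (sumSq-multiples (+ m) qa qb qc qd))

-- Take centred residues Aᵢ of aᵢ modulo m = 2 g + 1: ΣAᵢ² = m r with r < m, and r ≠ 0 as
-- otherwise m ∣ p.  In Euler's product of Σaᵢ² and ΣAᵢ² all four terms are divisible by m.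
descentStep : ∀ {p} g → Prime p → 1 ℕ.≤ g → suc (2 ℕ.* g) ℕ.< p →
  FourSquares (+ suc (2 ℕ.* g) * + p) →
  ∃ λ r → 1 ℕ.≤ r × r ℕ.< suc (2 ℕ.* g) × FourSquares (+ r * + p)
descentStep {p} g pr 1≤g m<p (fourSquares a b c d mp≡)
  with centredResidue g a | centredResidue g b | centredResidue g c | centredResidue g d
... | A , qa , refl , ∣A∣≤g | B , qb , refl , ∣B∣≤g | C , qc , refl , ∣C∣≤g | D , qd , refl , ∣D∣≤g =
  r , ℕ.n≢0⇒n>0 r≢0 , r<m , fourSquares-divide M A B C D qa qb qc qd mp≡ S≡M*r
  where
  m = suc (2 ℕ.* g)
  M = + m
  S = sumSq A B C D
  Sℕ = sumSqℕ (∣ A ∣) (∣ B ∣) (∣ C ∣) (∣ D ∣)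
  K = + 2 * (A * qa + B * qb + C * qc + D * qd) + M * sumSq qa qb qc qd
  S≡M*[p-K] : S ≡ M * (+ p - K)
  S≡M*[p-K] = M*p≡S+M*K⇒S≡M*[p-K] {M} {+ p} {S} {K} (trans mp≡ (sumSq-centred M A B C D qa qb qc qd))
  r = ∣ + p - K ∣
  Sℕ≡m*r : Sℕ ≡ m ℕ.* r
  Sℕ≡m*r = trans (cong ∣_∣ (trans (sym (sumSq≡sumSqℕ A B C D)) S≡M*[p-K])) (ℤ.abs-* M (+ p - K))
  S≡M*r : S ≡ M * + r
  S≡M*r = trans (sumSq≡sumSqℕ A B C D) (trans (cong +_ Sℕ≡m*r) (ℤ.pos-* m r))
  r<m : r ℕ.< m
  r<m = ℕ.*-cancelˡ-< m r m (subst (ℕ._< m ℕ.* m) Sℕ≡m*r (sumSqℕ<[1+2g]² ∣A∣≤g ∣B∣≤g ∣C∣≤g ∣D∣≤g))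
  instance
    m-nonTrivial : ℕ.NonTrivial m
    m-nonTrivial = ℕ.n>1⇒nonTrivial (s≤s (ℕ.≤-trans 1≤g (ℕ.m≤m+n g (g ℕ.+ 0))))
  r≢0 : r ≢ 0
  r≢0 r≡0 = prime⇒¬composite pr (composite m<p (zeroResidues⇒∣ m qa qb qc qd (trans mp≡ residues≡0)))
    where
    zeros = sumSqℕ≡0⇒≡0 (∣ A ∣) (∣ B ∣) (∣ C ∣) (∣ D ∣)
                        (trans Sℕ≡m*r (trans (cong (m ℕ.*_) r≡0) (ℕ.*-zeroʳ m)))
    residues≡0 : sumSq (A + M * qa) (B + M * qb) (C + M * qc) (D + M * qd) ≡
                 sumSq (+ 0 + M * qa) (+ 0 + M * qb) (+ 0 + M * qc) (+ 0 + M * qd)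
    residues≡0 = cong-sumSq (cong (_+ M * qa) (ℤ.∣i∣≡0⇒i≡0 {A} (proj₁ zeros)))
                            (cong (_+ M * qb) (ℤ.∣i∣≡0⇒i≡0 {B} (proj₁ (proj₂ zeros))))
                            (cong (_+ M * qc) (ℤ.∣i∣≡0⇒i≡0 {C} (proj₁ (proj₂ (proj₂ zeros)))))
                            (cong (_+ M * qd) (ℤ.∣i∣≡0⇒i≡0 {D} (proj₂ (proj₂ (proj₂ zeros)))))

data Parity : ℕ → Set where
  even : ∀ k → Parity (2 ℕ.* k)
  odd  : ∀ k → Parity (suc (2 ℕ.* k))

parity : ∀ n → Parity n
parity zero = even 0
parity (suc n) with parity n
... | even k = odd k
... | odd k  = subst Parity (cong suc (ℕ.+-suc k (k ℕ.+ 0))) (even (suc k))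

descent : ∀ {p} → Prime p → ∀ m → 1 ℕ.≤ m → m ℕ.< p → FourSquares (+ m * + p) → FourSquares (+ p)
descent {p} pr = <-rec P reduce
  where
  P : ℕ → Set
  P m = 1 ℕ.≤ m → m ℕ.< p → FourSquares (+ m * + p) → FourSquares (+ p)
  reduce : ∀ m → (∀ {k} → k ℕ.< m → P k) → P m
  reduce m rec 1≤m m<p mp with parity m
  ... | odd zero = subst FourSquares (ℤ.*-identityˡ (+ p)) mp
  ... | odd (suc g) with descentStep (suc g) pr (s≤s z≤n) m<p mp
  ...   | r , 1≤r , r<m , rp = rec r<m 1≤r (ℕ.<-trans r<m m<p) rp
  reduce m rec 1≤m m<p (fourSquares a b c d mp≡) | even k =
    rec k<m 1≤k (ℕ.<-trans k<m m<p) (fourSquares-half a b c d 2kp≡)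
    where
    1≤k : 1 ℕ.≤ k
    1≤k = ℕ.n≢0⇒n>0 λ { refl → ℕ.<⇒≱ 1≤m z≤n }
    k<m : k ℕ.< 2 ℕ.* k
    k<m = subst (k ℕ.<_) (cong (k ℕ.+_) (sym (ℕ.+-identityʳ k))) (ℕ.m<m+n k 1≤k)
    2kp≡ : + 2 * (+ k * + p) ≡ sumSq a b c d
    2kp≡ = trans (sym (ℤ.*-assoc (+ 2) (+ k) (+ p))) (trans (cong (_* + p) (sym (ℤ.pos-* 2 k))) mp≡)

pigeonhole-⊎ : ∀ {m n k} → k ℕ.< m ℕ.+ n → (f : Fin m ⊎ Fin n → Fin k) →
               ∃₂ λ u v → u ≢ v × f u ≡ f v
pigeonhole-⊎ {m} {n} k<m+n f with Fin.pigeonhole k<m+n (f ∘ splitAt m)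
... | i , j , i<j , fi≡fj = splitAt m i , splitAt m j , split≢ , fi≡fj
  where
  split≢ : splitAt m i ≢ splitAt m j
  split≢ eq = Fin.<-irrefl (begin
    i                    ≡⟨ Fin.join-splitAt m n i ⟨
    Fin.join m n (splitAt m i) ≡⟨ cong (Fin.join m n) eq ⟩
    Fin.join m n (splitAt m j) ≡⟨ Fin.join-splitAt m n j ⟩
    j                    ∎) i<j
    where open ≡-Reasoning

∣∧<⇒≡0 : ∀ {p n} → p ∣ n → n ℕ.< p → n ≡ 0
∣∧<⇒≡0 {n = zero}  _   _   = refl
∣∧<⇒≡0 {n = suc _} p∣n n<p = contradiction p∣n (>⇒∤ n<p)

%-≡⇒∣[x+y]*[x∸y] : ∀ {p x y} .{{_ : ℕ.NonZero p}} → y ℕ.≤ x →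
                     (x ℕ.* x) % p ≡ (y ℕ.* y) % p → p ∣ (x ℕ.+ y) ℕ.* (x ℕ.∸ y)
%-≡⇒∣[x+y]*[x∸y] {p} {x} {y} y≤x x²≡y² =
  ∣m+n∣m⇒∣n (divides ((x ℕ.* x) / p) (ℕ.+-cancelˡ-≡ ((y ℕ.* y) % p) _ _ (begin
    (y ℕ.* y) % p ℕ.+ ((y ℕ.* y) / p ℕ.* p ℕ.+ (x ℕ.+ y) ℕ.* d) ≡⟨ ℕ.+-assoc ((y ℕ.* y) % p) ((y ℕ.* y) / p ℕ.* p) _ ⟨
    (y ℕ.* y) % p ℕ.+ (y ℕ.* y) / p ℕ.* p ℕ.+ (x ℕ.+ y) ℕ.* d   ≡⟨ cong (ℕ._+ (x ℕ.+ y) ℕ.* d) (m≡m%n+[m/n]*n (y ℕ.* y) p) ⟨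
    y ℕ.* y ℕ.+ (x ℕ.+ y) ℕ.* d                                  ≡⟨ cong (λ x → y ℕ.* y ℕ.+ (x ℕ.+ y) ℕ.* d) x≡y+d ⟩
    y ℕ.* y ℕ.+ ((y ℕ.+ d) ℕ.+ y) ℕ.* d                          ≡⟨ square-expand y d ⟩
    (y ℕ.+ d) ℕ.* (y ℕ.+ d)                                      ≡⟨ cong (λ x → x ℕ.* x) x≡y+d ⟨
    x ℕ.* x                                                      ≡⟨ m≡m%n+[m/n]*n (x ℕ.* x) p ⟩
    (x ℕ.* x) % p ℕ.+ (x ℕ.* x) / p ℕ.* p                        ≡⟨ cong (ℕ._+ (x ℕ.* x) / p ℕ.* p) x²≡y² ⟩
    (y ℕ.* y) % p ℕ.+ (x ℕ.* x) / p ℕ.* p                        ∎)))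
    (n∣m*n ((y ℕ.* y) / p))
  where
  open ≡-Reasoning
  d = x ℕ.∸ y
  x≡y+d : x ≡ y ℕ.+ d
  x≡y+d = sym (ℕ.m+[n∸m]≡n y≤x)
  square-expand : ∀ y d → y ℕ.* y ℕ.+ ((y ℕ.+ d) ℕ.+ y) ℕ.* d ≡ (y ℕ.+ d) ℕ.* (y ℕ.+ d)
  square-expand = NS.solve-∀

square%-injective-≤ : ∀ {p x y} .{{_ : ℕ.NonZero p}} → Prime p → x ℕ.+ y ℕ.< p → y ℕ.≤ x →
                      (x ℕ.* x) % p ≡ (y ℕ.* y) % p → x ≡ y
square%-injective-≤ {x = x} {y} pr x+y<p y≤x x²≡y²
  with euclidsLemma (x ℕ.+ y) (x ℕ.∸ y) pr (%-≡⇒∣[x+y]*[x∸y] y≤x x²≡y²)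
... | inj₁ p∣x+y = trans (ℕ.m+n≡0⇒m≡0 x x+y≡0) (sym (ℕ.m+n≡0⇒n≡0 x x+y≡0))
  where x+y≡0 = ∣∧<⇒≡0 p∣x+y x+y<p
... | inj₂ p∣x∸y = ℕ.≤-antisym (ℕ.m∸n≡0⇒m≤n (∣∧<⇒≡0 p∣x∸y x∸y<p)) y≤x
  where x∸y<p = ℕ.≤-<-trans (ℕ.m∸n≤m x y) (ℕ.≤-<-trans (ℕ.m≤m+n x y) x+y<p)

square%-injective : ∀ {p x y} .{{_ : ℕ.NonZero p}} → Prime p → x ℕ.+ y ℕ.< p →
                    (x ℕ.* x) % p ≡ (y ℕ.* y) % p → x ≡ y
square%-injective {p} {x} {y} pr x+y<p x²≡y² with ℕ.≤-total y x
... | inj₁ y≤x = square%-injective-≤ pr x+y<p y≤x x²≡y²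
... | inj₂ x≤y = sym (square%-injective-≤ pr (subst (ℕ._< p) (ℕ.+-comm x y) x+y<p) x≤y (sym x²≡y²))

-- opposite i = p − 1 − i, so residue (inj₂ y) is −1 − y² modulo p.
module _ {h} (pr : Prime (suc (2 ℕ.* suc h))) where
  private
    p = suc (2 ℕ.* suc h)

    x+y<p : ∀ {x y} → x ℕ.≤ suc h → y ℕ.≤ suc h → x ℕ.+ y ℕ.< p
    x+y<p {x} {y} x≤ y≤ =
      s≤s (subst (x ℕ.+ y ℕ.≤_) (cong (suc h ℕ.+_) (sym (ℕ.+-identityʳ (suc h)))) (ℕ.+-mono-≤ x≤ y≤))

    sumSqℕ<p² : ∀ {x y} → x ℕ.≤ suc h → y ℕ.≤ suc h → sumSqℕ x y 1 0 ℕ.< p ℕ.* p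
    sumSqℕ<p² {x} {y} x≤ y≤ = begin-strict
      x ℕ.* x ℕ.+ y ℕ.* y ℕ.+ 1 ℕ.+ 0
        ≤⟨ ℕ.+-monoˡ-≤ 0 (ℕ.+-monoˡ-≤ 1 (ℕ.+-mono-≤ (ℕ.*-mono-≤ x≤ x≤) (ℕ.*-mono-≤ y≤ y≤))) ⟩
      H ℕ.* H ℕ.+ H ℕ.* H ℕ.+ 1 ℕ.+ 0      <⟨ ℕ.m<m+n _ (s≤s z≤n) ⟩
      H ℕ.* H ℕ.+ H ℕ.* H ℕ.+ 1 ℕ.+ 0 ℕ.+ suc (2 ℕ.* h ℕ.* h ℕ.+ 8 ℕ.* h ℕ.+ 5) ≡⟨ square h ⟩
      p ℕ.* p                              ∎
      where
      open ℕ.≤-Reasoning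
      H = suc h
      square : ∀ h → suc h ℕ.* suc h ℕ.+ suc h ℕ.* suc h ℕ.+ 1 ℕ.+ 0 ℕ.+ suc (2 ℕ.* h ℕ.* h ℕ.+ 8 ℕ.* h ℕ.+ 5)
                     ≡ suc (2 ℕ.* suc h) ℕ.* suc (2 ℕ.* suc h)
      square = NS.solve-∀

    p<[h+2]+[h+2] : p ℕ.< suc (suc h) ℕ.+ suc (suc h)
    p<[h+2]+[h+2] = ℕ.≤-reflexive (count h)
      where
      count : ∀ h → suc (suc (2 ℕ.* suc h)) ≡ suc (suc h) ℕ.+ suc (suc h)
      count = NS.solve-∀

    residue : Fin (suc (suc h)) ⊎ Fin (suc (suc h)) → Fin p
    residue (inj₁ x) = (toℕ x ℕ.* toℕ x) mod p
    residue (inj₂ y) = opposite ((toℕ y ℕ.* toℕ y) mod p)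

    opposite-injective : ∀ {i j : Fin p} → opposite i ≡ opposite j → i ≡ j
    opposite-injective {i} {j} eq =
      trans (sym (Fin.opposite-involutive i)) (trans (cong opposite eq) (Fin.opposite-involutive j))

    toℕ-mod : ∀ n → toℕ (n mod p) ≡ n % p
    toℕ-mod n = Fin.toℕ-fromℕ< (m%n<n n p)

    toℕ≤ : (x : Fin (suc (suc h))) → toℕ x ℕ.≤ suc h
    toℕ≤ x = ℕ.≤-pred (Fin.toℕ<n x)

    square-mod-injective : ∀ (x x′ : Fin (suc (suc h))) →
                           (toℕ x ℕ.* toℕ x) mod p ≡ (toℕ x′ ℕ.* toℕ x′) mod p → x ≡ x′
    square-mod-injective x x′ eq = Fin.toℕ-injective (square%-injective pr (x+y<p (toℕ≤ x) (toℕ≤ x′))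
      (trans (sym (toℕ-mod (toℕ x ℕ.* toℕ x))) (trans (cong toℕ eq) (toℕ-mod (toℕ x′ ℕ.* toℕ x′)))))

    collision⇒smallMultiple : ∀ x y → x ℕ.≤ suc h → y ℕ.≤ suc h → (x ℕ.* x) mod p ≡ opposite ((y ℕ.* y) mod p) →
                    ∃ λ m → 1 ℕ.≤ m × m ℕ.< p × FourSquares (+ m * + p)
    collision⇒smallMultiple x y x≤ y≤ eq = suc (qx ℕ.+ qy) , s≤s z≤n , m<p , fourSquares (+ x) (+ y) (+ 1) (+ 0) mp≡
      where
      rx = (x ℕ.* x) % p
      ry = (y ℕ.* y) % p
      qx = (x ℕ.* x) / p
      qy = (y ℕ.* y) / p
      rx≡p∸suc[ry] : rx ≡ p ℕ.∸ suc ry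
      rx≡p∸suc[ry] = begin
        rx                            ≡⟨ toℕ-mod (x ℕ.* x) ⟨
        toℕ ((x ℕ.* x) mod p)         ≡⟨ cong toℕ eq ⟩
        toℕ (opposite ((y ℕ.* y) mod p)) ≡⟨ Fin.opposite-prop ((y ℕ.* y) mod p) ⟩
        p ℕ.∸ suc (toℕ ((y ℕ.* y) mod p)) ≡⟨ cong (λ r → p ℕ.∸ suc r) (toℕ-mod (y ℕ.* y)) ⟩
        p ℕ.∸ suc ry                  ∎
        where open ≡-Reasoning
      sum≡ : sumSqℕ x y 1 0 ≡ suc (qx ℕ.+ qy) ℕ.* p
      sum≡ = begin
        x ℕ.* x ℕ.+ y ℕ.* y ℕ.+ 1 ℕ.+ 0
          ≡⟨ cong₂ (λ a b → a ℕ.+ b ℕ.+ 1 ℕ.+ 0) (m≡m%n+[m/n]*n (x ℕ.* x) p) (m≡m%n+[m/n]*n (y ℕ.* y) p) ⟩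
        rx ℕ.+ qx ℕ.* p ℕ.+ (ry ℕ.+ qy ℕ.* p) ℕ.+ 1 ℕ.+ 0 ≡⟨ regroup rx ry qx qy p ⟩
        (rx ℕ.+ suc ry) ℕ.+ (qx ℕ.+ qy) ℕ.* p  ≡⟨ cong (λ r → r ℕ.+ suc ry ℕ.+ (qx ℕ.+ qy) ℕ.* p) rx≡p∸suc[ry] ⟩
        (p ℕ.∸ suc ry ℕ.+ suc ry) ℕ.+ (qx ℕ.+ qy) ℕ.* p
          ≡⟨ cong (ℕ._+ (qx ℕ.+ qy) ℕ.* p) (ℕ.m∸n+n≡m (m%n<n (y ℕ.* y) p)) ⟩
        p ℕ.+ (qx ℕ.+ qy) ℕ.* p                ≡⟨⟩
        suc (qx ℕ.+ qy) ℕ.* p                  ∎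
        where
        open ≡-Reasoning
        regroup : ∀ rx ry qx qy p → rx ℕ.+ qx ℕ.* p ℕ.+ (ry ℕ.+ qy ℕ.* p) ℕ.+ 1 ℕ.+ 0 ≡
                                    (rx ℕ.+ suc ry) ℕ.+ (qx ℕ.+ qy) ℕ.* p
        regroup = NS.solve-∀
      m<p : suc (qx ℕ.+ qy) ℕ.< p
      m<p = ℕ.*-cancelʳ-< p _ p (subst (ℕ._< p ℕ.* p) sum≡ (sumSqℕ<p² x≤ y≤))
      mp≡ : + suc (qx ℕ.+ qy) * + p ≡ sumSq (+ x) (+ y) (+ 1) (+ 0)
      mp≡ = sym (trans (sumSq≡sumSqℕ (+ x) (+ y) (+ 1) (+ 0)) (trans (cong +_ sum≡) (ℤ.pos-* (suc (qx ℕ.+ qy)) p)))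

  smallMultiple : ∃ λ m → 1 ℕ.≤ m × m ℕ.< p × FourSquares (+ m * + p)
  smallMultiple with pigeonhole-⊎ p<[h+2]+[h+2] residue
  ... | inj₁ x , inj₁ x′ , x≢x′ , eq = contradiction (cong inj₁ (square-mod-injective x x′ eq)) x≢x′
  ... | inj₂ y , inj₂ y′ , y≢y′ , eq =
    contradiction (cong inj₂ (square-mod-injective y y′ (opposite-injective eq))) y≢y′
  ... | inj₁ x , inj₂ y , _ , eq = collision⇒smallMultiple (toℕ x) (toℕ y) (toℕ≤ x) (toℕ≤ y) eq
  ... | inj₂ y , inj₁ x , _ , eq = collision⇒smallMultiple (toℕ x) (toℕ y) (toℕ≤ x) (toℕ≤ y) (sym eq)

prime⇒fourSquares : ∀ {p} → Prime p → FourSquares (+ p)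
prime⇒fourSquares {p} pr with parity p
... | even zero          = contradiction pr ¬prime[0]
... | even (suc zero)    = fourSquares (+ 1) (+ 1) (+ 0) (+ 0) refl
... | even (suc (suc k)) = contradiction (composite 2<p (m∣m*n (suc (suc k)))) (prime⇒¬composite pr)
  where
  2<p : 2 ℕ.< 2 ℕ.* suc (suc k)
  2<p = ℕ.*-monoʳ-< 2 (s≤s (s≤s z≤n))
... | odd zero          = contradiction pr ¬prime[1]
... | odd (suc h) with smallMultiple pr
...   | m , 1≤m , m<p , mp = descent pr m 1≤m m<p mp

product-fourSquares : ∀ {ps} → All Prime ps → FourSquares (+ product ps)
product-fourSquares All.[]               = fourSquares (+ 1) (+ 0) (+ 0) (+ 0) refl
product-fourSquares {p ∷ ps} (pr All.∷ prs) =
  subst FourSquares (sym (ℤ.pos-* p (product ps))) (fourSquares-* (prime⇒fourSquares pr) (product-fourSquares prs))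

lagrangeFourSquares : ∀ n → FourSquares (+ n)
lagrangeFourSquares zero      = fourSquares (+ 0) (+ 0) (+ 0) (+ 0) refl
lagrangeFourSquares n@(suc _) = subst (FourSquares ∘ +_) (sym isFactorisation) (product-fourSquares factorsPrime)
  where open PrimeFactorisation (factorise n)

-- Generalized polygonal numbers

triangular : ℕ → ℕ
triangular zero    = 0
triangular (suc n) = suc n ℕ.+ triangular n

2*triangular : ∀ n → 2 ℕ.* triangular n ≡ n ℕ.* suc n
2*triangular zero    = refl
2*triangular (suc n) = begin
  2 ℕ.* (suc n ℕ.+ triangular n)          ≡⟨ ℕ.*-distribˡ-+ 2 (suc n) (triangular n) ⟩
  2 ℕ.* suc n ℕ.+ 2 ℕ.* triangular n      ≡⟨ cong (2 ℕ.* suc n ℕ.+_) (2*triangular n) ⟩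
  2 ℕ.* suc n ℕ.+ n ℕ.* suc n             ≡⟨ NS.solve (n ∷ []) ⟩
  suc n ℕ.* suc (suc n)                   ∎
  where open ≡-Reasoning

binom₂ : ℤ → ℕ
binom₂ (+ zero)  = 0
binom₂ (+ suc n) = triangular n
binom₂ -[1+ n ]  = triangular (suc n)

2*binom₂ : ∀ u → + 2 * + binom₂ u ≡ u * (u - + 1)
2*binom₂ (+ zero)  = refl
2*binom₂ (+ suc n) = begin
  + 2 * + triangular n            ≡⟨ ℤ.pos-* 2 (triangular n) ⟨
  + (2 ℕ.* triangular n)          ≡⟨ cong +_ (2*triangular n) ⟩
  + (n ℕ.* suc n)                 ≡⟨ ℤ.pos-* n (suc n) ⟩
  + n * (+ 1 + + n)               ≡⟨ shift (+ n) ⟩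
  (+ 1 + + n) * (+ 1 + + n - + 1) ∎
  where
  open ≡-Reasoning
  shift : ∀ x → x * (+ 1 + x) ≡ (+ 1 + x) * (+ 1 + x - + 1)
  shift = solve-∀
2*binom₂ -[1+ n ]  = begin
  + 2 * + triangular (suc n)                  ≡⟨ ℤ.pos-* 2 (triangular (suc n)) ⟨
  + (2 ℕ.* triangular (suc n))                ≡⟨ cong +_ (2*triangular (suc n)) ⟩
  + (suc n ℕ.* suc (suc n))                   ≡⟨ ℤ.pos-* (suc n) (suc (suc n)) ⟩
  (+ 1 + + n) * (+ 1 + (+ 1 + + n))           ≡⟨ negate (+ n) ⟩
  - (+ 1 + + n) * (- (+ 1 + + n) - + 1)       ∎
  where
  open ≡-Reasoning
  negate : ∀ x → (+ 1 + x) * (+ 1 + (+ 1 + x)) ≡ - (+ 1 + x) * (- (+ 1 + x) - + 1)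
  negate = solve-∀

polygonal : ℕ → ℤ → ℤ
polygonal m u = (+ m - + 2) * + binom₂ u + u

twiceP≡2*polygonal : ∀ m u → twiceP m u ≡ + 2 * polygonal m u
twiceP≡2*polygonal m u = begin
  (+ m - + 2) * (u * u) - (+ m - + 4) * u    ≡⟨ expand (+ m) u ⟩
  (+ m - + 2) * (u * (u - + 1)) + + 2 * u    ≡⟨ cong (λ b → (+ m - + 2) * b + + 2 * u) (2*binom₂ u) ⟨
  (+ m - + 2) * (+ 2 * + binom₂ u) + + 2 * u ≡⟨ factor (+ m) (+ binom₂ u) u ⟩
  + 2 * polygonal m u                        ∎
  where
  open ≡-Reasoning
  expand : ∀ M u → (M - + 2) * (u * u) - (M - + 4) * u ≡ (M - + 2) * (u * (u - + 1)) + + 2 * u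
  expand = solve-∀
  factor : ∀ M b u → (M - + 2) * (+ 2 * b) + + 2 * u ≡ + 2 * ((M - + 2) * b + u)
  factor = solve-∀

polygonal-isGP : ∀ m u → IsGP m (polygonal m u)
polygonal-isGP m u = u , sym (twiceP≡2*polygonal m u)

binom₂+binom₂-neg : ∀ u → + binom₂ u + + binom₂ (- u) ≡ u * u
binom₂+binom₂-neg u = ℤ.*-cancelˡ-≡ (+ 2) _ _ (begin
  + 2 * (+ binom₂ u + + binom₂ (- u))             ≡⟨ ℤ.*-distribˡ-+ (+ 2) (+ binom₂ u) (+ binom₂ (- u)) ⟩
  + 2 * + binom₂ u + + 2 * + binom₂ (- u)         ≡⟨ cong₂ _+_ (2*binom₂ u) (2*binom₂ (- u)) ⟩
  u * (u - + 1) + - u * (- u - + 1)               ≡⟨ solve (u ∷ []) ⟩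
  + 2 * (u * u)                                   ∎)
  where open ≡-Reasoning

polygonal+polygonal-neg : ∀ m u → polygonal m u + polygonal m (- u) ≡ (+ m - + 2) * (u * u)
polygonal+polygonal-neg m u = begin
  (+ m - + 2) * + binom₂ u + u + ((+ m - + 2) * + binom₂ (- u) + - u) ≡⟨ regroup (+ m) (+ binom₂ u) (+ binom₂ (- u)) u ⟩
  (+ m - + 2) * (+ binom₂ u + + binom₂ (- u))                         ≡⟨ cong ((+ m - + 2) *_) (binom₂+binom₂-neg u) ⟩
  (+ m - + 2) * (u * u)                                               ∎
  where
  open ≡-Reasoning
  regroup : ∀ M b b′ u → (M - + 2) * b + u + ((M - + 2) * b′ + - u) ≡ (M - + 2) * (b + b′)
  regroup = solve-∀

polygonal-nonneg : ∀ t u → polygonal (3 ℕ.+ t) u ≡ + (binom₂ (u + + 1) ℕ.+ t ℕ.* binom₂ u)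
polygonal-nonneg t u = ℤ.*-cancelˡ-≡ (+ 2) _ _ (begin
  + 2 * ((+ (3 ℕ.+ t) - + 2) * + B + u)                ≡⟨ cong (λ M → + 2 * ((M - + 2) * + B + u)) (ℤ.pos-+ 3 t) ⟩
  + 2 * ((+ 3 + + t - + 2) * + B + u)                  ≡⟨ distribute (+ t) (+ B) u ⟩
  (+ 1 + + t) * (+ 2 * + B) + + 2 * u                  ≡⟨ cong (λ b → (+ 1 + + t) * b + + 2 * u) (2*binom₂ u) ⟩
  (+ 1 + + t) * (u * (u - + 1)) + + 2 * u              ≡⟨ shift (+ t) u ⟩
  (u + + 1) * (u + + 1 - + 1) + + t * (u * (u - + 1))  ≡⟨ cong₂ (λ b b′ → b + + t * b′) (2*binom₂ (u + + 1)) (2*binom₂ u) ⟨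
  + 2 * + B₁ + + t * (+ 2 * + B)                       ≡⟨ factor (+ t) (+ B₁) (+ B) ⟩
  + 2 * (+ B₁ + + t * + B)                             ≡⟨ cong (λ b → + 2 * (+ B₁ + b)) (ℤ.pos-* t B) ⟨
  + 2 * (+ B₁ + + (t ℕ.* B))                           ≡⟨ cong (+ 2 *_) (ℤ.pos-+ B₁ (t ℕ.* B)) ⟨
  + 2 * + (B₁ ℕ.+ t ℕ.* B)                             ∎)
  where
  open ≡-Reasoning
  B  = binom₂ u
  B₁ = binom₂ (u + + 1)
  distribute : ∀ t b u → + 2 * ((+ 3 + t - + 2) * b + u) ≡ (+ 1 + t) * (+ 2 * b) + + 2 * u
  distribute = solve-∀
  shift : ∀ t u → (+ 1 + t) * (u * (u - + 1)) + + 2 * u ≡ (u + + 1) * (u + + 1 - + 1) + t * (u * (u - + 1))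
  shift = solve-∀
  factor : ∀ t b₁ b → + 2 * b₁ + t * (+ 2 * b) ≡ + 2 * (b₁ + t * b)
  factor = solve-∀

isGP⇒nonneg : ∀ {m s} → 3 ℕ.≤ m → IsGP m s → ∃ λ k → s ≡ + k
isGP⇒nonneg {s = s} (s≤s (s≤s (s≤s {n = t} z≤n))) (u , 2s≡) =
  binom₂ (u + + 1) ℕ.+ t ℕ.* binom₂ u ,
  trans (ℤ.*-cancelˡ-≡ (+ 2) s _ (trans 2s≡ (twiceP≡2*polygonal (3 ℕ.+ t) u))) (polygonal-nonneg t u)

-- The representing form

linComb-++ : ∀ k {l} (a : Fin (k ℕ.+ l) → ℕ) s →
  linComb (k ℕ.+ l) a s ≡ linComb k (a ∘ (_↑ˡ l)) (s ∘ (_↑ˡ l)) + linComb l (a ∘ (k ↑ʳ_)) (s ∘ (k ↑ʳ_))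
linComb-++ zero    a s = sym (ℤ.+-identityˡ _)
linComb-++ (suc k) a s = trans (cong (_+_ (+ a Fin.zero * s Fin.zero)) (linComb-++ k (a ∘ Fin.suc) (s ∘ Fin.suc)))
                               (sym (ℤ.+-assoc (+ a Fin.zero * s Fin.zero) _ _))

indicator : ∀ {l} → Fin l → Fin l → ℤ
indicator Fin.zero    Fin.zero    = + 1
indicator Fin.zero    (Fin.suc _) = + 0
indicator (Fin.suc _) Fin.zero    = + 0
indicator (Fin.suc r) (Fin.suc j) = indicator r j

linComb-zeros : ∀ l (a : Fin l → ℕ) → linComb l a (λ _ → + 0) ≡ + 0
linComb-zeros zero    a = refl
linComb-zeros (suc l) a = cong₂ _+_ (ℤ.*-zeroʳ (+ a Fin.zero)) (linComb-zeros l (a ∘ Fin.suc))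

linComb-indicator : ∀ l (a : Fin l → ℕ) r → linComb l a (indicator r) ≡ + a r
linComb-indicator (suc l) a Fin.zero    =
  trans (cong₂ _+_ (ℤ.*-identityʳ (+ a Fin.zero)) (linComb-zeros l (a ∘ Fin.suc))) (ℤ.+-identityʳ _)
linComb-indicator (suc l) a (Fin.suc r) =
  trans (cong₂ _+_ (ℤ.*-zeroʳ (+ a Fin.zero)) (linComb-indicator l (a ∘ Fin.suc) r)) (ℤ.+-identityˡ _)

0-isGP : ∀ m → IsGP m (+ 0)
0-isGP m = + 0 , P₀ (+ m)
  where
  P₀ : ∀ M → + 2 * + 0 ≡ (M - + 2) * (+ 0 * + 0) - (M - + 4) * + 0
  P₀ = solve-∀

1-isGP : ∀ m → IsGP m (+ 1)
1-isGP m = + 1 , P₁ (+ m)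
  where
  P₁ : ∀ M → + 2 * + 1 ≡ (M - + 2) * (+ 1 * + 1) - (M - + 4) * + 1
  P₁ = solve-∀

indicator-isGP : ∀ m {l} (r j : Fin l) → IsGP m (indicator r j)
indicator-isGP m Fin.zero    Fin.zero    = 1-isGP m
indicator-isGP m Fin.zero    (Fin.suc _) = 0-isGP m
indicator-isGP m (Fin.suc _) Fin.zero    = 0-isGP m
indicator-isGP m (Fin.suc r) (Fin.suc j) = indicator-isGP m r j

linComb-zeroOr≥ : ∀ {n} k (a : Fin k → ℕ) (s : Fin k → ℤ) → (∀ i → n ≤ a i) → (∀ i → ∃ λ j → s i ≡ + j) →
                  ∃ λ K → linComb k a s ≡ + K × (K ≡ 0 ⊎ n ≤ K)
linComb-zeroOr≥ zero    a s n≤a s≥0 = 0 , refl , inj₁ refl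
linComb-zeroOr≥ {n} (suc k) a s n≤a s≥0
  with s≥0 Fin.zero | linComb-zeroOr≥ k (a ∘ Fin.suc) (s ∘ Fin.suc) (n≤a ∘ Fin.suc) (s≥0 ∘ Fin.suc)
... | j , s₀≡j | K , rest≡K , K≡0⊎n≤K = a₀ ℕ.* j ℕ.+ K , sum≡ , bound j
  where
  a₀ = a Fin.zero
  sum≡ : + a₀ * s Fin.zero + linComb k (a ∘ Fin.suc) (s ∘ Fin.suc) ≡ + (a₀ ℕ.* j ℕ.+ K)
  sum≡ = begin
    + a₀ * s Fin.zero + linComb k (a ∘ Fin.suc) (s ∘ Fin.suc) ≡⟨ cong₂ (λ x y → + a₀ * x + y) s₀≡j rest≡K ⟩
    + a₀ * + j + + K                                         ≡⟨ cong (_+ + K) (ℤ.pos-* a₀ j) ⟨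
    + (a₀ ℕ.* j) + + K                                       ≡⟨ ℤ.pos-+ (a₀ ℕ.* j) K ⟨
    + (a₀ ℕ.* j ℕ.+ K)                                       ∎
    where open ≡-Reasoning
  bound : ∀ j → a₀ ℕ.* j ℕ.+ K ≡ 0 ⊎ n ≤ a₀ ℕ.* j ℕ.+ K
  bound zero    = subst (λ z → z ℕ.+ K ≡ 0 ⊎ n ≤ z ℕ.+ K) (sym (ℕ.*-zeroʳ a₀)) K≡0⊎n≤K
  bound (suc j) = inj₂ (ℕ.≤-trans (n≤a Fin.zero) (ℕ.≤-trans (ℕ.m≤m*n a₀ (suc j)) (ℕ.m≤m+n _ K)))

represented′⇒≥ : ∀ {m n k a x} → 3 ≤ m → (∀ i → n ≤ a i) → Represented' m k a x → + n ℤ.≤ x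
represented′⇒≥ {k = k} {a} 3≤m n≤a ((s , s∈GP , x≡) , x≢0)
  with linComb-zeroOr≥ k a s n≤a (λ i → isGP⇒nonneg 3≤m (s∈GP i))
... | K , sum≡K , inj₁ K≡0 = contradiction (trans x≡ (trans sum≡K (cong +_ K≡0))) x≢0
... | K , sum≡K , inj₂ n≤K = subst (+ _ ℤ.≤_) (sym (trans x≡ sum≡K)) (+≤+ n≤K)

plusMinus : ℤ → ℤ → ℤ → ℤ → Fin 8 → ℤ
plusMinus u₁ u₂ u₃ u₄ Fin.zero                                                      = u₁
plusMinus u₁ u₂ u₃ u₄ (Fin.suc Fin.zero)                                            = - u₁
plusMinus u₁ u₂ u₃ u₄ (Fin.suc (Fin.suc Fin.zero))                                  = u₂
plusMinus u₁ u₂ u₃ u₄ (Fin.suc (Fin.suc (Fin.suc Fin.zero)))                        = - u₂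
plusMinus u₁ u₂ u₃ u₄ (Fin.suc (Fin.suc (Fin.suc (Fin.suc Fin.zero))))              = u₃
plusMinus u₁ u₂ u₃ u₄ (Fin.suc (Fin.suc (Fin.suc (Fin.suc (Fin.suc Fin.zero)))))    = - u₃
plusMinus u₁ u₂ u₃ u₄ (Fin.suc (Fin.suc (Fin.suc (Fin.suc (Fin.suc (Fin.suc Fin.zero)))))) = u₄
plusMinus u₁ u₂ u₃ u₄ (Fin.suc (Fin.suc (Fin.suc (Fin.suc (Fin.suc (Fin.suc (Fin.suc Fin.zero))))))) = - u₄

linComb-polygonalPairs : ∀ m n u₁ u₂ u₃ u₄ →
  linComb 8 (λ _ → n) (polygonal m ∘ plusMinus u₁ u₂ u₃ u₄) ≡ + n * ((+ m - + 2) * sumSq u₁ u₂ u₃ u₄)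
linComb-polygonalPairs m n u₁ u₂ u₃ u₄ = begin
  A * P u₁ + (A * P (- u₁) + (A * P u₂ + (A * P (- u₂) + (A * P u₃ + (A * P (- u₃) + (A * P u₄ + (A * P (- u₄) + + 0)))))))
    ≡⟨ regroup A (P u₁) (P (- u₁)) (P u₂) (P (- u₂)) (P u₃) (P (- u₃)) (P u₄) (P (- u₄)) ⟩
  A * ((P u₁ + P (- u₁)) + (P u₂ + P (- u₂)) + (P u₃ + P (- u₃)) + (P u₄ + P (- u₄)))
    ≡⟨ cong (A *_) (cong₂ _+_ (cong₂ _+_ (cong₂ _+_ (pair u₁) (pair u₂)) (pair u₃)) (pair u₄)) ⟩
  A * (B * (u₁ * u₁) + B * (u₂ * u₂) + B * (u₃ * u₃) + B * (u₄ * u₄))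
    ≡⟨ cong (A *_) (factor B u₁ u₂ u₃ u₄) ⟩
  A * (B * sumSq u₁ u₂ u₃ u₄)
    ∎
  where
  open ≡-Reasoning
  A = + n
  B = + m - + 2
  P = polygonal m
  pair = polygonal+polygonal-neg m
  regroup : ∀ A p₁ p₂ p₃ p₄ p₅ p₆ p₇ p₈ →
    A * p₁ + (A * p₂ + (A * p₃ + (A * p₄ + (A * p₅ + (A * p₆ + (A * p₇ + (A * p₈ + + 0)))))))
    ≡ A * ((p₁ + p₂) + (p₃ + p₄) + (p₅ + p₆) + (p₇ + p₈))
  regroup = solve-∀
  factor : ∀ B u₁ u₂ u₃ u₄ →
           B * (u₁ * u₁) + B * (u₂ * u₂) + B * (u₃ * u₃) + B * (u₄ * u₄) ≡ B * sumSq u₁ u₂ u₃ u₄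
  factor = solveₚ 5 (λ B u₁ u₂ u₃ u₄ → B :* (u₁ :* u₁) :+ B :* (u₂ :* u₂) :+ B :* (u₃ :* u₃) :+ B :* (u₄ :* u₄)
                                       := B :* sumSqₚ u₁ u₂ u₃ u₄) refl

-- n is added on the right so that the coefficient reduces to n at each of the first eight
-- indices and to toℕ j + n at 8 ↑ʳ j.
coefficients : ℕ → ∀ l → Fin (8 ℕ.+ l) → ℕ
coefficients n l i = (toℕ i ℕ.∸ 8) ℕ.+ n

coefficients-≥ : ∀ n l i → n ≤ coefficients n l i
coefficients-≥ n l i = ℕ.m≤n+m n (toℕ i ℕ.∸ 8)

coefficients-∈𝒩 : ∀ {n} l → 1 ≤ n → InN (8 ℕ.+ l) (coefficients n l)
coefficients-∈𝒩 {n} l 1≤n = (λ i → ℕ.≤-trans 1≤n (coefficients-≥ n l i)) ,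
                            (λ i j i≤j → ℕ.+-monoˡ-≤ n (ℕ.∸-monoˡ-≤ 8 i≤j))

representation : ℕ → ℤ → ℤ → ℤ → ℤ → ∀ {l} → Fin l → Fin (8 ℕ.+ l) → ℤ
representation m u₁ u₂ u₃ u₄ r i = [ polygonal m ∘ plusMinus u₁ u₂ u₃ u₄ , indicator r ]′ (splitAt 8 i)

representation-isGP : ∀ m u₁ u₂ u₃ u₄ {l} (r : Fin l) i → IsGP m (representation m u₁ u₂ u₃ u₄ r i)
representation-isGP m u₁ u₂ u₃ u₄ r i with splitAt 8 i
... | inj₁ j = polygonal-isGP m (plusMinus u₁ u₂ u₃ u₄ j)
... | inj₂ j = indicator-isGP m r j

linComb-representation : ∀ m n u₁ u₂ u₃ u₄ {l} (r : Fin l) →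
  linComb (8 ℕ.+ l) (coefficients n l) (representation m u₁ u₂ u₃ u₄ r) ≡
  + n * ((+ m - + 2) * sumSq u₁ u₂ u₃ u₄) + + (toℕ r ℕ.+ n)
linComb-representation m n u₁ u₂ u₃ u₄ {l} r =
  trans (linComb-++ 8 (coefficients n l) (representation m u₁ u₂ u₃ u₄ r))
        (cong₂ _+_ (linComb-polygonalPairs m n u₁ u₂ u₃ u₄) (linComb-indicator l (λ j → toℕ j ℕ.+ n) r))

≡quotient*l+[remainder+n] : ∀ {n X} l .{{_ : ℕ.NonZero l}} → n ≤ X →
                            X ≡ (X ℕ.∸ n) / l ℕ.* l ℕ.+ (toℕ ((X ℕ.∸ n) mod l) ℕ.+ n)
≡quotient*l+[remainder+n] {n} {X} l n≤X = begin
  X                            ≡⟨ ℕ.m∸n+n≡m n≤X ⟨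
  D ℕ.+ n                      ≡⟨ cong (ℕ._+ n) (m≡m%n+[m/n]*n D l) ⟩
  D % l ℕ.+ D / l ℕ.* l ℕ.+ n  ≡⟨ cong (λ R → R ℕ.+ D / l ℕ.* l ℕ.+ n) (Fin.toℕ-fromℕ< (m%n<n D l)) ⟨
  R ℕ.+ D / l ℕ.* l ℕ.+ n      ≡⟨ regroup R (D / l ℕ.* l) n ⟩
  D / l ℕ.* l ℕ.+ (R ℕ.+ n)    ∎
  where
  open ≡-Reasoning
  D = X ℕ.∸ n
  R = toℕ (D mod l)
  regroup : ∀ r q n → r ℕ.+ q ℕ.+ n ≡ q ℕ.+ (r ℕ.+ n)
  regroup = NS.solve-∀

≥⇒represented′ : ∀ t n′ x → let n = suc n′; l = n ℕ.* suc t in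
                 + n ℤ.≤ x → Represented' (3 ℕ.+ t) (8 ℕ.+ l) (coefficients n l) x
≥⇒represented′ t n′ (+ X) (+≤+ n≤X) =
  (representation m u₁ u₂ u₃ u₄ r , representation-isGP m u₁ u₂ u₃ u₄ r , X≡) , X≢0
  where
  n = suc n′
  m = 3 ℕ.+ t
  l = n ℕ.* suc t
  Q = (X ℕ.∸ n) / l
  r = (X ℕ.∸ n) mod l
  open FourSquares (lagrangeFourSquares Q) renaming (x₁ to u₁; x₂ to u₂; x₃ to u₃; x₄ to u₄)
  X≡ : + X ≡ linComb (8 ℕ.+ l) (coefficients n l) (representation m u₁ u₂ u₃ u₄ r)
  X≡ = begin
    + X                                                        ≡⟨ cong +_ (≡quotient*l+[remainder+n] l n≤X) ⟩
    + (Q ℕ.* l ℕ.+ (toℕ r ℕ.+ n))                              ≡⟨ ℤ.pos-+ (Q ℕ.* l) (toℕ r ℕ.+ n) ⟩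
    + (Q ℕ.* l) + + (toℕ r ℕ.+ n)                              ≡⟨ cong (_+ + (toℕ r ℕ.+ n)) Q*l≡ ⟩
    + n * ((+ m - + 2) * sumSq u₁ u₂ u₃ u₄) + + (toℕ r ℕ.+ n)  ≡⟨ linComb-representation m n u₁ u₂ u₃ u₄ r ⟨
    linComb (8 ℕ.+ l) (coefficients n l) (representation m u₁ u₂ u₃ u₄ r) ∎
    where
    open ≡-Reasoning
    Q*l≡ : + (Q ℕ.* l) ≡ + n * ((+ m - + 2) * sumSq u₁ u₂ u₃ u₄)
    Q*l≡ = begin
      + (Q ℕ.* (n ℕ.* suc t))              ≡⟨ ℤ.pos-* Q (n ℕ.* suc t) ⟩
      + Q * + (n ℕ.* suc t)                ≡⟨ cong (+ Q *_) (ℤ.pos-* n (suc t)) ⟩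
      + Q * (+ n * + suc t)                ≡⟨ rotate (+ Q) (+ n) (+ suc t) ⟩
      + n * (+ suc t * + Q)                ≡⟨ cong (λ q → + n * (+ suc t * q)) n≡sumSq ⟩
      + n * ((+ m - + 2) * sumSq u₁ u₂ u₃ u₄) ∎
      where
      rotate : ∀ q n s → q * (n * s) ≡ n * (s * q)
      rotate = solve-∀
  X≢0 : + X ≢ + 0
  X≢0 refl = contradiction n≤X λ ()

lemma2p1 : (m n : ℕ) → 3 ≤ m → 1 ≤ n →
    Σ ℕ λ k → 1 ≤ k × Σ (Fin k → ℕ) λ a → InN k a ×
      ((x : ℤ) → Represented' m k a x ⇔ (+ n ℤ.≤ x))
lemma2p1 m (suc n′) 3≤m@(s≤s (s≤s (s≤s {n = t} z≤n))) 1≤n =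
  8 ℕ.+ l , s≤s z≤n , coefficients n l , coefficients-∈𝒩 l 1≤n ,
  λ x → mk⇔ (represented′⇒≥ 3≤m (coefficients-≥ n l)) (≥⇒represented′ t n′ x)
  where
  n = suc n′
  l = n ℕ.* suc t
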